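{- Let $\mathcal{F}=\langle X,R^+,R^-\rangle$ be a collectively connected symmetric signed frame. Then $\mathcal{F}$ has the local balance property if and only if both $R^+$ and $R^-$ are collusive.
   Context: A symmetric signed frame is a tuple $\langle X,R^+,R^-\rangle$ with $X$ a set and $R^+,R^-\subseteq X\times X$ such that: $R^+$ is reflexive and symmetric; $R^-$ is symmetric; and $R^+,R^-$ are non-overlapping, i.e. $\forall x,y\in X.\ \neg(xR^+y)\vee\neg(xR^-y)$. It is collectively connected if moreover $\forall x,y\in X.\ (xR^+y \vee xR^-y)$. It has the local balance property (is balanced) iff for all $x,y,z\in X$: (1) $((xR^+y\wedge yR^+z)\vee(xR^-y\wedge yR^-z))\Rightarrow xR^+z$, and (2) $((xR^+y\wedge yR^-z)\vee(xR^-y\wedge yR^+z))\Rightarrow xR^-z$. A relation $S$ on $X$ is collusive iff $\forall x,y,z,w\in X\,\big((xSy\wedge xSz\wedge wSy)\Rightarrow wSz\big)$. -}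

module Defs where

open import Level using (Level; _⊔_; suc)
open import Data.Product using (_×_)
open import Data.Sum using (_⊎_)
open import Relation.Nullary using (¬_)
open import Relation.Binary using (Rel; Reflexive; Symmetric)

record SymmetricSignedFrame (a ℓ : Level) : Set (Level.suc (a ⊔ ℓ)) where
  field
    X           : Set a
    R⁺          : Rel X ℓ
    R⁻          : Rel X ℓ
    R⁺-refl     : Reflexive R⁺
    R⁺-sym      : Symmetric R⁺
    R⁻-sym      : Symmetric R⁻
    nonOverlap  : ∀ x y → ¬ (R⁺ x y) ⊎ ¬ (R⁻ x y)

module _ {a ℓ : Level} (F : SymmetricSignedFrame a ℓ) where
  open SymmetricSignedFrame F

  CollectivelyConnected : Set (a ⊔ ℓ)
  CollectivelyConnected = ∀ x y → R⁺ x y ⊎ R⁻ x y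

  LocallyBalanced : Set (a ⊔ ℓ)
  LocallyBalanced =
    (∀ x y z → (R⁺ x y × R⁺ y z) ⊎ (R⁻ x y × R⁻ y z) → R⁺ x z)
    × (∀ x y z → (R⁺ x y × R⁻ y z) ⊎ (R⁻ x y × R⁺ y z) → R⁻ x z)

Collusive : {a ℓ : Level} {X : Set a} → Rel X ℓ → Set (a ⊔ ℓ)
Collusive {X = X} S = ∀ (x y z w : X) → S x y → S x z → S w y → S w z

-- Balance alone already makes both relations collusive: chaining the two
-- balance clauses along w – y – x – z turns w·y into w·x and then w·z.
-- Conversely, for the reflexive symmetric R⁺ collusiveness is transitivity,
-- and collusiveness of R⁻ forbids two R⁻-neighbours of a point from being
-- R⁻-related (that would make R⁻ reflexive somewhere). Collective
-- connectedness turns each of these "not R⁻"/"not R⁺" conclusions into the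
-- required R⁺/R⁻ relation.
module Submission where

open import Defs
open import Level using (Level)
open import Data.Product using (_×_; _,_)
open import Data.Sum using (_⊎_; inj₁; inj₂)
open import Data.Empty using (⊥-elim)
open import Function.Bundles using (_⇔_; mk⇔)
open import Relation.Nullary using (¬_)
open import Relation.Binary using (Rel; Reflexive; Symmetric; Transitive)

collusive⇒transitive : ∀ {a ℓ} {X : Set a} {S : Rel X ℓ} →
  Reflexive S → Symmetric S → Collusive S → Transitive S
collusive⇒transitive refl sym collusive {x} {y} {z} xy yz =
  collusive y x z x (sym xy) yz refl

module _ {a ℓ : Level} (F : SymmetricSignedFrame a ℓ) where
  open SymmetricSignedFrame F

  R⁺⇒¬R⁻ : ∀ {x y} → R⁺ x y → ¬ R⁻ x y
  R⁺⇒¬R⁻ {x} {y} p m with nonOverlap x y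
  ... | inj₁ ¬p = ¬p p
  ... | inj₂ ¬m = ¬m m

  R⁻-irrefl : ∀ {x} → ¬ R⁻ x x
  R⁻-irrefl = R⁺⇒¬R⁻ R⁺-refl

  balanced⇒R⁺-collusive : LocallyBalanced F → Collusive R⁺
  balanced⇒R⁺-collusive (same , _) x y z w xy xz wy =
    same w x z (inj₁ (wx , xz))
    where wx = same w y x (inj₁ (wy , R⁺-sym xy))

  balanced⇒R⁻-collusive : LocallyBalanced F → Collusive R⁻
  balanced⇒R⁻-collusive (same , opposite) x y z w xy xz wy =
    opposite w x z (inj₁ (wx , xz))
    where wx = same w y x (inj₂ (wy , R⁻-sym xy))

  module _ (connected : CollectivelyConnected F) where

    ¬R⁻⇒R⁺ : ∀ {x y} → ¬ R⁻ x y → R⁺ x y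
    ¬R⁻⇒R⁺ {x} {y} ¬m with connected x y
    ... | inj₁ p = p
    ... | inj₂ m = ⊥-elim (¬m m)

    ¬R⁺⇒R⁻ : ∀ {x y} → ¬ R⁺ x y → R⁻ x y
    ¬R⁺⇒R⁻ {x} {y} ¬p with connected x y
    ... | inj₁ p = ⊥-elim (¬p p)
    ... | inj₂ m = m

    collusive⇒balanced : Collusive R⁺ → Collusive R⁻ → LocallyBalanced F
    collusive⇒balanced collusive⁺ collusive⁻ = same , opposite
      where
      trans⁺ : Transitive R⁺
      trans⁺ = collusive⇒transitive R⁺-refl R⁺-sym collusive⁺

      same : ∀ x y z → (R⁺ x y × R⁺ y z) ⊎ (R⁻ x y × R⁻ y z) → R⁺ x z
      same x y z (inj₁ (xy , yz)) = trans⁺ xy yz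
      same x y z (inj₂ (xy , yz)) = ¬R⁻⇒R⁺ λ xz →
        R⁻-irrefl (collusive⁻ y z x x yz (R⁻-sym xy) xz)

      opposite : ∀ x y z → (R⁺ x y × R⁻ y z) ⊎ (R⁻ x y × R⁺ y z) → R⁻ x z
      opposite x y z (inj₁ (xy , yz)) = ¬R⁺⇒R⁻ λ xz →
        R⁺⇒¬R⁻ (trans⁺ (R⁺-sym xy) xz) yz
      opposite x y z (inj₂ (xy , yz)) = ¬R⁺⇒R⁻ λ xz →
        R⁺⇒¬R⁻ (trans⁺ xz (R⁺-sym yz)) xy

mainTheorem7 : {a ℓ : Level} (F : SymmetricSignedFrame a ℓ) →
    CollectivelyConnected F →
    (LocallyBalanced F ⇔ (Collusive (SymmetricSignedFrame.R⁺ F) × Collusive (SymmetricSignedFrame.R⁻ F)))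
mainTheorem7 F connected = mk⇔
  (λ balanced → balanced⇒R⁺-collusive F balanced , balanced⇒R⁻-collusive F balanced)
  (λ (collusive⁺ , collusive⁻) → collusive⇒balanced F connected collusive⁺ collusive⁻)
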